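{- For each of the fourteen sequent calculi $\mathsf{G1ML}$ listed in the context, the rule $\mathsf{cut}$: from $\Gamma\Rightarrow A$ and $\Sigma,A\Rightarrow C$ infer $\Gamma,\Sigma\Rightarrow C$, is admissible in $\mathsf{G1ML}$ (whenever both premisses are derivable, so is the conclusion).
   Context: Formulas: $A ::= p \mid \bot \mid A\wedge A \mid A\vee A \mid A\to A \mid \Box A \mid \Diamond A$. Sequents $\Gamma\Rightarrow C$: $\Gamma$ a finite multiset of formulas, $C$ one formula; $\Box\Sigma$ prefixes $\Box$ to each member of multiset $\Sigma$. Derivations are finite trees from initial sequents via rules. $\mathsf{G1MPL}$: initial sequents $A\Rightarrow A$; (L$\wedge$) $\Gamma,A_i\Rightarrow C$ / $\Gamma,A_1\wedge A_2\Rightarrow C$; (R$\wedge$) $\Gamma\Rightarrow A$, $\Gamma\Rightarrow B$ / $\Gamma\Rightarrow A\wedge B$; (L$\vee$) $\Gamma,A\Rightarrow C$, $\Gamma,B\Rightarrow C$ / $\Gamma,A\vee B\Rightarrow C$; (R$\vee$) $\Gamma\Rightarrow A_i$ / $\Gamma\Rightarrow A_1\vee A_2$; (R$\to$) $\Gamma,A\Rightarrow B$ / $\Gamma\Rightarrow A\to B$; (L$\to$) $\Gamma\Rightarrow A$, $\Gamma,B\Rightarrow C$ / $\Gamma,A\to B\Rightarrow C$; (LW) $\Gamma\Rightarrow C$ / $\Gamma,A\Rightarrow C$; (LC) $\Gamma,A,A\Rightarrow C$ / $\Gamma,A\Rightarrow C$. Modal rules: (M$\Box$) $A\Rightarrow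 B$ / $\Box A\Rightarrow\Box B$; (M$\Diamond$) $A\Rightarrow B$ / $\Diamond A\Rightarrow\Diamond B$; (N$\Box$) $\Rightarrow A$ / $\Rightarrow\Box A$; (C$\Box$) $\Sigma,A\Rightarrow B$ / $\Box\Sigma,\Box A\Rightarrow\Box B$; (K$\Box$) $\Sigma\Rightarrow A$ / $\Box\Sigma\Rightarrow\Box A$; (K$\Diamond$) $\Sigma,A\Rightarrow B$ / $\Box\Sigma,\Diamond A\Rightarrow\Diamond B$; (P$\Diamond$) $\Rightarrow A$ / $\Rightarrow\Diamond A$; (D) $A\Rightarrow B$ / $\Box A\Rightarrow\Diamond B$; (CD) $\Sigma\Rightarrow A$ / $\Box\Sigma\Rightarrow\Diamond A$; (T$\Box$) $\Gamma,A\Rightarrow C$ / $\Gamma,\Box A\Rightarrow C$; (T$\Diamond$) $\Gamma\Rightarrow A$ / $\Gamma\Rightarrow\Diamond A$. Each calculus is $\mathsf{G1MPL}$ plus: $\mathsf{G1MM}$: M$\Box$, M$\Diamond$; $\mathsf{G1MMP}$: $\mathsf{G1MM}$+P$\Diamond$; $\mathsf{G1MMN}$: $\mathsf{G1MM}$+N$\Box$; $\mathsf{G1MMNP}$: $\mathsf{G1MMN}$+P$\Diamond$; $\mathsf{G1MMC}$: C$\Box$, K$\Diamond$; $\mathsf{G1MK}$: K$\Box$, K$\Diamond$; $\mathsf{G1MMD}$: $\mathsf{G1MM}$+D+P$\Diamond$; $\mathsf{G1MMT}$: $\mathsf{G1MM}$+T$\Box$+T$\Diamond$; $\mathsf{G1MMND}$: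 $\mathsf{G1MMN}$+D+P$\Diamond$; $\mathsf{G1MMNT}$: $\mathsf{G1MMN}$+T$\Box$+T$\Diamond$; $\mathsf{G1MMCD}$: $\mathsf{G1MMC}$+CD; $\mathsf{G1MMCT}$: $\mathsf{G1MMC}$+T$\Box$+T$\Diamond$; $\mathsf{G1MKD}$: $\mathsf{G1MK}$+CD; $\mathsf{G1MKT}$: $\mathsf{G1MK}$+T$\Box$+T$\Diamond$. -}

module Defs where

open import Data.Nat using (ℕ)
open import Data.List using (List; []; _∷_; _++_; map)
open import Data.List.Relation.Binary.Permutation.Propositional using (_↭_)
open import Data.Bool using (Bool; true; false)
open import Relation.Binary.PropositionalEquality using (_≡_)

data Fm : Set where
  var  : ℕ → Fm
  ⊥'   : Fm
  _∧'_ : Fm → Fm → Fm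
  _∨'_ : Fm → Fm → Fm
  _⇒'_ : Fm → Fm → Fm
  □_   : Fm → Fm
  ◇_   : Fm → Fm

-- Finite multisets of formulas are represented by lists; the derivability
-- relation is closed under permutation of the antecedent (rule 'perm'), so
-- that it is a relation on multisets.  "Γ , A" is  A ∷ Γ , "Γ , Σ" is Γ ++ Σ.
Ctx : Set
Ctx = List Fm

□* : Ctx → Ctx
□* = map □_

data Calc : Set where
  MM MMP MMN MMNP MMC MK MMD MMT MMND MMNT MMCD MMCT MKD MKT : Calc

hasM hasN hasP hasC hasK hasKD hasD hasCD hasT : Calc → Bool

hasM MM = true
hasM MMP = true
hasM MMN = true
hasM MMNP = true
hasM MMD = true
hasM MMT = true
hasM MMND = true
hasM MMNT = true
hasM _ = false

hasN MMN = true
hasN MMNP = true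
hasN MMND = true
hasN MMNT = true
hasN _ = false

hasP MMP = true
hasP MMNP = true
hasP MMD = true
hasP MMND = true
hasP _ = false

hasC MMC = true
hasC MMCD = true
hasC MMCT = true
hasC _ = false

hasK MK = true
hasK MKD = true
hasK MKT = true
hasK _ = false

hasKD MMC = true
hasKD MMCD = true
hasKD MMCT = true
hasKD MK = true
hasKD MKD = true
hasKD MKT = true
hasKD _ = false

hasD MMD = true
hasD MMND = true
hasD _ = false

hasCD MMCD = true
hasCD MKD = true
hasCD _ = false

hasT MMT = true
hasT MMNT = true
hasT MMCT = true
hasT MKT = true
hasT _ = false

data _⊢_⇒_ (L : Calc) : Ctx → Fm → Set where
  perm : ∀ {Γ Δ C} → Γ ↭ Δ → L ⊢ Γ ⇒ C → L ⊢ Δ ⇒ C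
  ax   : ∀ {A} → L ⊢ A ∷ [] ⇒ A
  L∧₁  : ∀ {Γ A B C} → L ⊢ A ∷ Γ ⇒ C → L ⊢ (A ∧' B) ∷ Γ ⇒ C
  L∧₂  : ∀ {Γ A B C} → L ⊢ B ∷ Γ ⇒ C → L ⊢ (A ∧' B) ∷ Γ ⇒ C
  R∧   : ∀ {Γ A B} → L ⊢ Γ ⇒ A → L ⊢ Γ ⇒ B → L ⊢ Γ ⇒ (A ∧' B)
  L∨   : ∀ {Γ A B C} → L ⊢ A ∷ Γ ⇒ C → L ⊢ B ∷ Γ ⇒ C → L ⊢ (A ∨' B) ∷ Γ ⇒ C
  R∨₁  : ∀ {Γ A B} → L ⊢ Γ ⇒ A → L ⊢ Γ ⇒ (A ∨' B)
  R∨₂  : ∀ {Γ A B} → L ⊢ Γ ⇒ B → L ⊢ Γ ⇒ (A ∨' B)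
  R⇒   : ∀ {Γ A B} → L ⊢ A ∷ Γ ⇒ B → L ⊢ Γ ⇒ (A ⇒' B)
  L⇒   : ∀ {Γ A B C} → L ⊢ Γ ⇒ A → L ⊢ B ∷ Γ ⇒ C → L ⊢ (A ⇒' B) ∷ Γ ⇒ C
  LW   : ∀ {Γ A C} → L ⊢ Γ ⇒ C → L ⊢ A ∷ Γ ⇒ C
  LC   : ∀ {Γ A C} → L ⊢ A ∷ A ∷ Γ ⇒ C → L ⊢ A ∷ Γ ⇒ C
  M□   : ∀ {A B} → hasM L ≡ true → L ⊢ A ∷ [] ⇒ B → L ⊢ (□ A) ∷ [] ⇒ (□ B)
  M◇   : ∀ {A B} → hasM L ≡ true → L ⊢ A ∷ [] ⇒ B → L ⊢ (◇ A) ∷ [] ⇒ (◇ B)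
  N□   : ∀ {A} → hasN L ≡ true → L ⊢ [] ⇒ A → L ⊢ [] ⇒ (□ A)
  C□   : ∀ {Σ A B} → hasC L ≡ true → L ⊢ A ∷ Σ ⇒ B → L ⊢ (□ A) ∷ □* Σ ⇒ (□ B)
  K□   : ∀ {Σ A} → hasK L ≡ true → L ⊢ Σ ⇒ A → L ⊢ □* Σ ⇒ (□ A)
  K◇   : ∀ {Σ A B} → hasKD L ≡ true → L ⊢ A ∷ Σ ⇒ B → L ⊢ (◇ A) ∷ □* Σ ⇒ (◇ B)
  P◇   : ∀ {A} → hasP L ≡ true → L ⊢ [] ⇒ A → L ⊢ [] ⇒ (◇ A)
  D    : ∀ {A B} → hasD L ≡ true → L ⊢ A ∷ [] ⇒ B → L ⊢ (□ A) ∷ [] ⇒ (◇ B)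
  CD   : ∀ {Σ A} → hasCD L ≡ true → L ⊢ Σ ⇒ A → L ⊢ □* Σ ⇒ (◇ A)
  T□   : ∀ {Γ A C} → hasT L ≡ true → L ⊢ A ∷ Γ ⇒ C → L ⊢ (□ A) ∷ Γ ⇒ C
  T◇   : ∀ {Γ A} → hasT L ≡ true → L ⊢ Γ ⇒ A → L ⊢ Γ ⇒ (◇ A)

-- Gentzen's method, applied to multicut: from Γ ⇒ A and a sequent whose antecedent contains n copies
-- of A, derive the sequent in which those copies are replaced by Γ. Cutting all copies at once is what
-- lets the induction pass contractions on the cut formula. The induction is on A and, for fixed A, on
-- the left premise and then on the right one: the cut moves up the left premise until it ends in a
-- right rule introducing A, then up the right premise until A is principal there, where it becomes cuts
-- on the immediate subformulas of A. At a modal rule the two side contexts merge into one accepted by a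
-- modal rule of the same calculus; this depends on which modal rules occur together in the fourteen
-- calculi (D, for instance, occurs only with P◇ and never with C□, K□ or K◇), checked by exhaustion.

module Submission where

open import Defs
open import Data.Bool using (true; _≟_)
open import Data.Empty using (⊥-elim)
open import Data.List using (List; []; _∷_; [_]; _++_; replicate)
open import Data.List.Properties using (map-++; ∷-injective)
open import Data.List.Membership.Propositional using (_∈_)
open import Data.List.Membership.Propositional.Properties using (∈-++⁻; ∈-∃++)
open import Data.List.Relation.Unary.All using (lookup; all?)
open import Data.List.Relation.Unary.Any using (here; there)
open import Data.List.Relation.Binary.Permutation.Propositional
open import Data.List.Relation.Binary.Permutation.Propositional.Properties
open import Algebra.Solver.CommutativeMonoid (++-commutativeMonoid {A = Fm}) using (solve; _⊜_; _⊕_)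
open import Data.Nat using (ℕ; zero; suc)
open import Data.Product using (∃; ∃₂; _×_; _,_)
open import Data.Sum using (inj₁; inj₂)
open import Data.Unit using (⊤)
open import Relation.Binary.PropositionalEquality using (_≡_; refl)
open import Relation.Nullary using (¬_; Dec; ¬?; _→-dec_)
open import Relation.Nullary.Decidable using (True; toWitness)

calculi : List Calc
calculi = MM ∷ MMP ∷ MMN ∷ MMNP ∷ MMC ∷ MK ∷ MMD ∷ MMT ∷ MMND ∷ MMNT ∷ MMCD ∷ MMCT ∷ MKD ∷ MKT ∷ []

∈-calculi : ∀ L → L ∈ calculi
∈-calculi MM   = here refl
∈-calculi MMP  = there (here refl)
∈-calculi MMN  = there (there (here refl))
∈-calculi MMNP = there (there (there (here refl)))
∈-calculi MMC  = there (there (there (there (here refl))))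
∈-calculi MK   = there (there (there (there (there (here refl)))))
∈-calculi MMD  = there (there (there (there (there (there (here refl))))))
∈-calculi MMT  = there (there (there (there (there (there (there (here refl)))))))
∈-calculi MMND = there (there (there (there (there (there (there (there (here refl))))))))
∈-calculi MMNT = there (there (there (there (there (there (there (there (there (here refl)))))))))
∈-calculi MMCD = there (there (there (there (there (there (there (there (there (there (here refl))))))))))
∈-calculi MMCT = there (there (there (there (there (there (there (there (there (there (there (here refl)))))))))))
∈-calculi MKD  = there (there (there (there (there (there (there (there (there (there (there (there (here refl))))))))))))
∈-calculi MKT  = there (there (there (there (there (there (there (there (there (there (there (there (there (here refl)))))))))))))

byExhaustion : {P : Calc → Set} (P? : ∀ L → Dec (P L)) → {True (all? P? calculi)} → ∀ L → P L
byExhaustion P? {holds} L = lookup (toWitness holds) (∈-calculi L)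

hasD⇒hasP : ∀ L → hasD L ≡ true → hasP L ≡ true
hasD⇒hasP = byExhaustion λ L → hasD L ≟ true →-dec hasP L ≟ true

hasC⇒¬hasD : ∀ L → hasC L ≡ true → ¬ hasD L ≡ true
hasC⇒¬hasD = byExhaustion λ L → hasC L ≟ true →-dec ¬? (hasD L ≟ true)

hasK⇒¬hasD : ∀ L → hasK L ≡ true → ¬ hasD L ≡ true
hasK⇒¬hasD = byExhaustion λ L → hasK L ≟ true →-dec ¬? (hasD L ≟ true)

hasP⇒¬hasKD : ∀ L → hasP L ≡ true → ¬ hasKD L ≡ true
hasP⇒¬hasKD = byExhaustion λ L → hasP L ≟ true →-dec ¬? (hasKD L ≟ true)

hasD⇒¬hasKD : ∀ L → hasD L ≡ true → ¬ hasKD L ≡ true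
hasD⇒¬hasKD = byExhaustion λ L → hasD L ≟ true →-dec ¬? (hasKD L ≟ true)

hasCD⇒¬hasM : ∀ L → hasCD L ≡ true → ¬ hasM L ≡ true
hasCD⇒¬hasM = byExhaustion λ L → hasCD L ≟ true →-dec ¬? (hasM L ≟ true)

¬[]↭∷ : ∀ {A : Set} {x : A} {xs} → ¬ ([] ↭ x ∷ xs)
¬[]↭∷ p = ¬x∷xs↭[] (↭-sym p)

↭-prep-replicate : ∀ {A : Set} n {x a : A} {ys zs} → ys ↭ replicate n a ++ zs → x ∷ ys ↭ replicate n a ++ x ∷ zs
↭-prep-replicate n {x} {a} {zs = zs} p = trans (prep x p) (↭-sym (shift x (replicate n a) zs))

∈-replicate⁻ : ∀ {A : Set} n {x y : A} → x ∈ replicate n y → x ≡ y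
∈-replicate⁻ (suc n) (here x≡y) = x≡y
∈-replicate⁻ (suc n) (there x∈) = ∈-replicate⁻ n x∈

singleton↭replicate-inv : ∀ {A : Set} {x y : A} m {zs} → [ x ] ↭ replicate (suc m) y ++ zs → x ≡ y × m ≡ 0 × zs ≡ []
singleton↭replicate-inv zero {[]} p with ↭-singleton-inv (↭-sym p)
... | refl = refl , refl , refl
singleton↭replicate-inv zero {_ ∷ _} p with ↭-singleton-inv (↭-sym p)
... | ()
singleton↭replicate-inv (suc m) p with ↭-singleton-inv (↭-sym p)
... | ()

data Occurrence {A : Set} (m : ℕ) (a : A) (zs : List A) : A → List A → Set where
  cut-formula  : ∀ {ys} → ys ↭ replicate m a ++ zs → Occurrence m a zs a ys
  side-formula : ∀ {x ys zs′} → zs ↭ x ∷ zs′ → ys ↭ replicate (suc m) a ++ zs′ → Occurrence m a zs x ys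

occurrence : ∀ {A : Set} m {a x : A} {ys zs} → x ∷ ys ↭ replicate (suc m) a ++ zs → Occurrence m a zs x ys
occurrence m {a} {x} p with ∈-++⁻ (replicate (suc m) a) (∈-resp-↭ p (here refl))
... | inj₁ x∈ with ∈-replicate⁻ (suc m) x∈
...   | refl = cut-formula (drop-∷ p)
occurrence m {a} {x} p | inj₂ x∈ with ∈-∃++ x∈
... | xs , ys , refl = side-formula (shift x xs ys) (drop-∷ (trans p x-to-front))
  where
  x-to-front : replicate (suc m) a ++ xs ++ x ∷ ys ↭ x ∷ replicate (suc m) a ++ xs ++ ys
  x-to-front = trans (++⁺ˡ (replicate (suc m) a) (shift x xs ys)) (shift x (replicate (suc m) a) (xs ++ ys))

□*≡replicate++-inv : ∀ m {A Σ Δ} → replicate (suc m) A ++ Σ ≡ □* Δ →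
                     ∃₂ λ A₀ Σ₀ → A ≡ □ A₀ × Σ ≡ □* Σ₀ × Δ ≡ replicate (suc m) A₀ ++ Σ₀
□*≡replicate++-inv m {Δ = []} ()
□*≡replicate++-inv zero {Δ = A₀ ∷ Σ₀} refl = A₀ , Σ₀ , refl , refl , refl
□*≡replicate++-inv (suc m) {Δ = A₀ ∷ Δ} eq with ∷-injective eq
... | refl , eq′ with □*≡replicate++-inv m eq′
...   | _ , Σ₀ , refl , refl , refl = A₀ , Σ₀ , refl , refl , refl

□*↭replicate++-inv : ∀ m {A Σ Δ} → □* Δ ↭ replicate (suc m) A ++ Σ →
                     ∃₂ λ A₀ Σ₀ → A ≡ □ A₀ × Σ ≡ □* Σ₀ × Δ ↭ replicate (suc m) A₀ ++ Σ₀
□*↭replicate++-inv m p with ↭-map-inv □_ p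
... | _ , eq , Δ↭ with □*≡replicate++-inv m eq
...   | A₀ , Σ₀ , refl , refl , refl = A₀ , Σ₀ , refl , refl , Δ↭

□*↭replicate◇++-inv : ∀ m {B Σ Δ} → □* Δ ↭ replicate m (◇ B) ++ Σ → m ≡ 0 × ∃ λ Σ₀ → Σ ≡ □* Σ₀ × Δ ↭ Σ₀
□*↭replicate◇++-inv zero p with ↭-map-inv □_ p
... | Σ₀ , refl , Δ↭ = refl , Σ₀ , refl , Δ↭
□*↭replicate◇++-inv (suc m) p with ↭-map-inv □_ p
... | [] , () , _
... | _ ∷ _ , () , _

□*-++-↭ : ∀ Γ {Δ Σ} → Δ ↭ Σ → □* (Γ ++ Δ) ↭ □* Γ ++ □* Σ
□*-++-↭ Γ {Δ} p = trans (↭-reflexive (map-++ □_ Γ Δ)) (++⁺ˡ (□* Γ) (map⁺ □_ p))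

module _ (L : Calc) where

  weakenˡ* : ∀ Γ {Σ C} → L ⊢ Σ ⇒ C → L ⊢ Γ ++ Σ ⇒ C
  weakenˡ* []      d = d
  weakenˡ* (A ∷ Γ) d = LW (weakenˡ* Γ d)

  weakenʳ* : ∀ {Γ} Σ {C} → L ⊢ Γ ⇒ C → L ⊢ Γ ++ Σ ⇒ C
  weakenʳ* {Γ} Σ d = perm (++-comm Σ Γ) (weakenˡ* Σ d)

  contract* : ∀ Γ {Σ C} → L ⊢ Γ ++ Γ ++ Σ ⇒ C → L ⊢ Γ ++ Σ ⇒ C
  contract* []      d = d
  contract* (A ∷ Γ) {Σ} d =
    perm (shift A Γ Σ) (contract* Γ (perm A-to-back (LC (perm (prep A (shift A Γ (Γ ++ Σ))) d))))
    where
    A-to-back : A ∷ Γ ++ Γ ++ Σ ↭ Γ ++ Γ ++ A ∷ Σ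
    A-to-back = solve 3 (λ a g s → a ⊕ (g ⊕ (g ⊕ s)) ⊜ g ⊕ (g ⊕ (a ⊕ s))) refl [ A ] Γ Σ

  contract-replicate : ∀ m {A Σ C} → L ⊢ A ∷ replicate m A ++ Σ ⇒ C → L ⊢ A ∷ Σ ⇒ C
  contract-replicate zero    d = d
  contract-replicate (suc m) d = contract-replicate m (LC d)

  T□* : hasT L ≡ true → ∀ Γ {Σ C} → L ⊢ Γ ++ Σ ⇒ C → L ⊢ □* Γ ++ Σ ⇒ C
  T□* h []      d = d
  T□* h (A ∷ Γ) {Σ} d =
    perm (shift (□ A) (□* Γ) Σ) (T□* h Γ (perm (↭-sym (shift (□ A) Γ Σ)) (T□ h d)))

  moveFront : ∀ Γ {B Σ C} → L ⊢ Γ ++ B ∷ Σ ⇒ C → L ⊢ B ∷ Γ ++ Σ ⇒ C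
  moveFront Γ {B} {Σ} = perm (shift B Γ Σ)

  moveBack : ∀ Γ {B Σ Σ′ C} → Σ ↭ B ∷ Σ′ → L ⊢ B ∷ Γ ++ Σ′ ⇒ C → L ⊢ Γ ++ Σ ⇒ C
  moveBack Γ {B} {Σ′ = Σ′} q = perm (trans (↭-sym (shift B Γ Σ′)) (++⁺ˡ Γ (↭-sym q)))

  leftRule-middle : ∀ Γ {B B′ Σ Σ′ C} → (∀ {Π} → L ⊢ B′ ∷ Π ⇒ C → L ⊢ B ∷ Π ⇒ C) →
                    Σ ↭ B ∷ Σ′ → L ⊢ Γ ++ B′ ∷ Σ′ ⇒ C → L ⊢ Γ ++ Σ ⇒ C
  leftRule-middle Γ rule q d = moveBack Γ q (rule (moveFront Γ d))

  data □Rule : Ctx → Set where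
    byN□ : hasN L ≡ true → □Rule []
    byM□ : ∀ {A} → hasM L ≡ true → □Rule [ A ]
    byC□ : ∀ {A Σ} → hasC L ≡ true → □Rule (A ∷ Σ)
    byK□ : ∀ {Σ} → hasK L ≡ true → □Rule Σ

  data ◇Rule : Ctx → Set where
    byM◇ : hasM L ≡ true → ◇Rule []
    byK◇ : ∀ {Σ} → hasKD L ≡ true → ◇Rule Σ

  data □◇Rule : Ctx → Set where
    byP◇ : hasP L ≡ true → □◇Rule []
    byD  : ∀ {A} → hasD L ≡ true → □◇Rule [ A ]
    byCD : ∀ {Σ} → hasCD L ≡ true → □◇Rule Σ

  □-rule : ∀ {Σ B} → □Rule Σ → L ⊢ Σ ⇒ B → L ⊢ □* Σ ⇒ (□ B)
  □-rule (byN□ h) = N□ h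
  □-rule (byM□ h) = M□ h
  □-rule (byC□ h) = C□ h
  □-rule (byK□ h) = K□ h

  ◇-rule : ∀ {Σ A B} → ◇Rule Σ → L ⊢ A ∷ Σ ⇒ B → L ⊢ (◇ A) ∷ □* Σ ⇒ (◇ B)
  ◇-rule (byM◇ h) = M◇ h
  ◇-rule (byK◇ h) = K◇ h

  □◇-rule : ∀ {Σ B} → □◇Rule Σ → L ⊢ Σ ⇒ B → L ⊢ □* Σ ⇒ (◇ B)
  □◇-rule (byP◇ h) = P◇ h
  □◇-rule (byD h)  = D h
  □◇-rule (byCD h) = CD h

  □Rule-cut : ∀ m {Γ Δ Σ A} → □Rule Γ → □Rule Δ → Δ ↭ replicate (suc m) A ++ Σ → □Rule (Γ ++ Σ)
  □Rule-cut m _         (byK□ h) _ = byK□ h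
  □Rule-cut m (byK□ h)  _        _ = byK□ h
  □Rule-cut m (byC□ h)  _        _ = byC□ h
  □Rule-cut m _         (byN□ _) p = ⊥-elim (¬[]↭∷ p)
  □Rule-cut m (byN□ h)  (byM□ _) p with singleton↭replicate-inv m p
  ... | _ , refl , refl = byN□ h
  □Rule-cut m (byM□ h)  (byM□ _) p with singleton↭replicate-inv m p
  ... | _ , refl , refl = byM□ h
  □Rule-cut m {Σ = []}    (byN□ h) (byC□ _) _ = byN□ h
  □Rule-cut m {Σ = _ ∷ _} (byN□ _) (byC□ h) _ = byC□ h
  □Rule-cut m             (byM□ _) (byC□ h) _ = byC□ h

  ◇Rule-++ : ∀ {Γ Δ} → ◇Rule Γ → ◇Rule Δ → ◇Rule (Γ ++ Δ)
  ◇Rule-++ (byK◇ h) _        = byK◇ h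
  ◇Rule-++ (byM◇ _) (byK◇ h) = byK◇ h
  ◇Rule-++ (byM◇ h) (byM◇ _) = byM◇ h

  ◇Rule-cut : ∀ m {Γ Δ Σ A} → ◇Rule Δ → Δ ↭ replicate (suc m) A ++ Σ → ◇Rule (Γ ++ Σ)
  ◇Rule-cut m (byM◇ _) p = ⊥-elim (¬[]↭∷ p)
  ◇Rule-cut m (byK◇ h) _ = byK◇ h

  □◇Rule-++-◇Rule : ∀ {Γ Δ} → □◇Rule Γ → ◇Rule Δ → □◇Rule (Γ ++ Δ)
  □◇Rule-++-◇Rule (byCD h) (byK◇ _) = byCD h
  □◇Rule-++-◇Rule (byCD h) (byM◇ h′) = ⊥-elim (hasCD⇒¬hasM L h h′)
  □◇Rule-++-◇Rule (byP◇ h) (byM◇ _) = byP◇ h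
  □◇Rule-++-◇Rule (byP◇ h) (byK◇ h′) = ⊥-elim (hasP⇒¬hasKD L h h′)
  □◇Rule-++-◇Rule (byD h)  (byM◇ _) = byD h
  □◇Rule-++-◇Rule (byD h)  (byK◇ h′) = ⊥-elim (hasD⇒¬hasKD L h h′)

  □◇Rule-cut : ∀ m {Γ Δ Σ A} → □Rule Γ → □◇Rule Δ → Δ ↭ replicate (suc m) A ++ Σ → □◇Rule (Γ ++ Σ)
  □◇Rule-cut m _        (byCD h) _ = byCD h
  □◇Rule-cut m _        (byP◇ _) p = ⊥-elim (¬[]↭∷ p)
  □◇Rule-cut m (byN□ _) (byD h)  p with singleton↭replicate-inv m p
  ... | _ , refl , refl = byP◇ (hasD⇒hasP L h)
  □◇Rule-cut m (byM□ _) (byD h)  p with singleton↭replicate-inv m p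
  ... | _ , refl , refl = byD h
  □◇Rule-cut m (byC□ h) (byD h′) _ = ⊥-elim (hasC⇒¬hasD L h h′)
  □◇Rule-cut m (byK□ h) (byD h′) _ = ⊥-elim (hasK⇒¬hasD L h h′)

  data RightIntro : Ctx → Fm → Set where
    ∧-intro  : ∀ {Γ A B} → L ⊢ Γ ⇒ A → L ⊢ Γ ⇒ B → RightIntro Γ (A ∧' B)
    ∨₁-intro : ∀ {Γ A B} → L ⊢ Γ ⇒ A → RightIntro Γ (A ∨' B)
    ∨₂-intro : ∀ {Γ A B} → L ⊢ Γ ⇒ B → RightIntro Γ (A ∨' B)
    ⇒-intro  : ∀ {Γ A B} → L ⊢ A ∷ Γ ⇒ B → RightIntro Γ (A ⇒' B)
    □-intro  : ∀ {Γ A} → □Rule Γ → L ⊢ Γ ⇒ A → RightIntro (□* Γ) (□ A)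
    ◇-intro  : ∀ {Γ A B} → ◇Rule Γ → L ⊢ A ∷ Γ ⇒ B → RightIntro ((◇ A) ∷ □* Γ) (◇ B)
    □◇-intro : ∀ {Γ A} → □◇Rule Γ → L ⊢ Γ ⇒ A → RightIntro (□* Γ) (◇ A)
    T◇-intro : ∀ {Γ A} → hasT L ≡ true → L ⊢ Γ ⇒ A → RightIntro Γ (◇ A)

  MultiCut : Fm → Set
  MultiCut A = ∀ n {Γ Δ Σ C} → L ⊢ Γ ⇒ A → L ⊢ Δ ⇒ C → Δ ↭ replicate n A ++ Σ → L ⊢ Γ ++ Σ ⇒ C

  MultiCutSub : Fm → Set
  MultiCutSub (var _)  = ⊤
  MultiCutSub ⊥'       = ⊤
  MultiCutSub (A ∧' B) = MultiCut A × MultiCut B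
  MultiCutSub (A ∨' B) = MultiCut A × MultiCut B
  MultiCutSub (A ⇒' B) = MultiCut A × MultiCut B
  MultiCutSub (□ A)    = MultiCut A
  MultiCutSub (◇ A)    = MultiCut A

  cut-middle : ∀ {A} → MultiCut A → ∀ Π {Γ Σ C} → L ⊢ Γ ⇒ A → L ⊢ Π ++ A ∷ Σ ⇒ C → L ⊢ Γ ++ Π ++ Σ ⇒ C
  cut-middle {A} mc Π {Σ = Σ} d e = mc 1 d e (shift A Π Σ)

  principal-∧₁ : ∀ {Γ Σ A B C} → MultiCutSub (A ∧' B) → RightIntro Γ (A ∧' B) →
                 L ⊢ Γ ++ A ∷ Σ ⇒ C → L ⊢ Γ ++ Σ ⇒ C
  principal-∧₁ {Γ} (mcA , _) (∧-intro dA _) e = contract* Γ (cut-middle mcA Γ dA e)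

  principal-∧₂ : ∀ {Γ Σ A B C} → MultiCutSub (A ∧' B) → RightIntro Γ (A ∧' B) →
                 L ⊢ Γ ++ B ∷ Σ ⇒ C → L ⊢ Γ ++ Σ ⇒ C
  principal-∧₂ {Γ} (_ , mcB) (∧-intro _ dB) e = contract* Γ (cut-middle mcB Γ dB e)

  principal-∨ : ∀ {Γ Σ A B C} → MultiCutSub (A ∨' B) → RightIntro Γ (A ∨' B) →
                L ⊢ Γ ++ A ∷ Σ ⇒ C → L ⊢ Γ ++ B ∷ Σ ⇒ C → L ⊢ Γ ++ Σ ⇒ C
  principal-∨ {Γ} (mcA , _) (∨₁-intro dA) eA _ = contract* Γ (cut-middle mcA Γ dA eA)
  principal-∨ {Γ} (_ , mcB) (∨₂-intro dB) _ eB = contract* Γ (cut-middle mcB Γ dB eB)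

  principal-⇒ : ∀ {Γ Σ A B C} → MultiCutSub (A ⇒' B) → RightIntro Γ (A ⇒' B) →
                L ⊢ Γ ++ Σ ⇒ A → L ⊢ Γ ++ B ∷ Σ ⇒ C → L ⊢ Γ ++ Σ ⇒ C
  principal-⇒ {Γ} {Σ} (mcA , mcB) (⇒-intro d) eA eB =
    contract* Γ (perm regroup′ (contract* (Γ ++ Σ) (perm regroup (cut-middle mcB Γ dB eB))))
    where
    dB : L ⊢ (Γ ++ Σ) ++ Γ ⇒ _
    dB = mcA 1 eA d ↭-refl
    regroup : ((Γ ++ Σ) ++ Γ) ++ Γ ++ Σ ↭ (Γ ++ Σ) ++ (Γ ++ Σ) ++ Γ
    regroup = solve 2 (λ g s → ((g ⊕ s) ⊕ g) ⊕ (g ⊕ s) ⊜ (g ⊕ s) ⊕ ((g ⊕ s) ⊕ g)) refl Γ Σ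
    regroup′ : (Γ ++ Σ) ++ Γ ↭ Γ ++ Γ ++ Σ
    regroup′ = solve 2 (λ g s → (g ⊕ s) ⊕ g ⊜ g ⊕ (g ⊕ s)) refl Γ Σ

  principal-T□ : ∀ {Γ Σ A C} → hasT L ≡ true → MultiCutSub (□ A) → RightIntro Γ (□ A) →
                 L ⊢ Γ ++ A ∷ Σ ⇒ C → L ⊢ Γ ++ Σ ⇒ C
  principal-T□ h mc (□-intro {Γ} _ d) e = contract* (□* Γ) (T□* h Γ (cut-middle mc (□* Γ) d e))

  cut-□rule : ∀ m {A Γ Δ Σ B} → MultiCutSub A → RightIntro Γ A → □Rule Δ → L ⊢ Δ ⇒ B →
              □* Δ ↭ replicate (suc m) A ++ Σ → L ⊢ Γ ++ Σ ⇒ (□ B)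
  cut-□rule m mc ri r d p with □*↭replicate++-inv m p
  ... | _ , Σ₀ , refl , refl , q with ri
  ...   | □-intro {Γ₀} r₀ d₀ = perm (□*-++-↭ Γ₀ ↭-refl) (□-rule (□Rule-cut m r₀ r q) (mc (suc m) d₀ d q))

  cut-□◇rule : ∀ m {A Γ Δ Σ B} → MultiCutSub A → RightIntro Γ A → □◇Rule Δ → L ⊢ Δ ⇒ B →
               □* Δ ↭ replicate (suc m) A ++ Σ → L ⊢ Γ ++ Σ ⇒ (◇ B)
  cut-□◇rule m mc ri r d p with □*↭replicate++-inv m p
  ... | _ , Σ₀ , refl , refl , q with ri
  ...   | □-intro {Γ₀} r₀ d₀ = perm (□*-++-↭ Γ₀ ↭-refl) (□◇-rule (□◇Rule-cut m r₀ r q) (mc (suc m) d₀ d q))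

  cut-◇rule-principal : ∀ {A Γ Δ Σ B} → MultiCut A → RightIntro Γ (◇ A) → ◇Rule Δ → L ⊢ A ∷ Δ ⇒ B →
                        Δ ↭ Σ → L ⊢ Γ ++ □* Σ ⇒ (◇ B)
  cut-◇rule-principal mc (◇-intro {Γ₀} {A₀} r₀ d₀) r d q =
    perm (prep (◇ A₀) (□*-++-↭ Γ₀ q)) (◇-rule (◇Rule-++ r₀ r) (mc 1 d₀ d ↭-refl))
  cut-◇rule-principal mc (□◇-intro {Γ₀} r₀ d₀) r d q =
    perm (□*-++-↭ Γ₀ q) (□◇-rule (□◇Rule-++-◇Rule r₀ r) (mc 1 d₀ d ↭-refl))
  cut-◇rule-principal {Δ = Δ} mc (T◇-intro {Γ} h d₀) r d q =
    T◇ h (perm (trans (++-comm (□* Δ) Γ) (++⁺ˡ Γ (map⁺ □_ q))) (T□* h Δ (perm (++-comm Γ Δ) (mc 1 d₀ d ↭-refl))))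

  cut-◇rule : ∀ m {A Γ Δ Σ B₁ B} → MultiCutSub A → RightIntro Γ A → ◇Rule Δ → L ⊢ B₁ ∷ Δ ⇒ B →
              (◇ B₁) ∷ □* Δ ↭ replicate (suc m) A ++ Σ → L ⊢ Γ ++ Σ ⇒ (◇ B)
  cut-◇rule m mc ri r d p with occurrence m p
  ... | cut-formula q with □*↭replicate◇++-inv m q
  ...   | refl , _ , refl , q′ = cut-◇rule-principal mc ri r d q′
  cut-◇rule m mc ri r d p | side-formula q q′ with □*↭replicate++-inv m q′
  ... | A₀ , Σ₀ , refl , refl , q″ with ri
  ...   | □-intro {Γ₀} r₀ d₀ =
          moveBack (□* Γ₀) q (perm (prep _ (□*-++-↭ Γ₀ ↭-refl))
            (◇-rule (◇Rule-cut m r q″) (moveFront Γ₀ (mc (suc m) d₀ d (↭-prep-replicate (suc m) q″)))))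

  module _ {A} (mc : MultiCutSub A) where

    mcutˡ : MultiCut A
    mcutʳ : ∀ m {Γ Δ Σ C} → L ⊢ Γ ⇒ A → RightIntro Γ A → L ⊢ Δ ⇒ C →
            Δ ↭ replicate (suc m) A ++ Σ → L ⊢ Γ ++ Σ ⇒ C

    mcutˡ zero    {Γ} _ e p = weakenˡ* Γ (perm p e)
    mcutˡ (suc m) {Σ = Σ} (perm q d) e p = perm (++⁺ʳ Σ q) (mcutˡ (suc m) d e p)
    mcutˡ (suc m) ax e p = contract-replicate m (perm p e)
    mcutˡ (suc m) (L∧₁ d) e p = L∧₁ (mcutˡ (suc m) d e p)
    mcutˡ (suc m) (L∧₂ d) e p = L∧₂ (mcutˡ (suc m) d e p)
    mcutˡ (suc m) (L∨ d₁ d₂) e p = L∨ (mcutˡ (suc m) d₁ e p) (mcutˡ (suc m) d₂ e p)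
    mcutˡ (suc m) {Σ = Σ} (L⇒ d₁ d₂) e p = L⇒ (weakenʳ* Σ d₁) (mcutˡ (suc m) d₂ e p)
    mcutˡ (suc m) (LW d) e p = LW (mcutˡ (suc m) d e p)
    mcutˡ (suc m) (LC d) e p = LC (mcutˡ (suc m) d e p)
    mcutˡ (suc m) (T□ h d) e p = T□ h (mcutˡ (suc m) d e p)
    mcutˡ (suc m) d@(R∧ d₁ d₂) e p = mcutʳ m d (∧-intro d₁ d₂) e p
    mcutˡ (suc m) d@(R∨₁ d₁) e p = mcutʳ m d (∨₁-intro d₁) e p
    mcutˡ (suc m) d@(R∨₂ d₂) e p = mcutʳ m d (∨₂-intro d₂) e p
    mcutˡ (suc m) d@(R⇒ d₁) e p = mcutʳ m d (⇒-intro d₁) e p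
    mcutˡ (suc m) d@(N□ h d₁) e p = mcutʳ m d (□-intro (byN□ h) d₁) e p
    mcutˡ (suc m) d@(M□ h d₁) e p = mcutʳ m d (□-intro (byM□ h) d₁) e p
    mcutˡ (suc m) d@(C□ h d₁) e p = mcutʳ m d (□-intro (byC□ h) d₁) e p
    mcutˡ (suc m) d@(K□ h d₁) e p = mcutʳ m d (□-intro (byK□ h) d₁) e p
    mcutˡ (suc m) d@(M◇ h d₁) e p = mcutʳ m d (◇-intro (byM◇ h) d₁) e p
    mcutˡ (suc m) d@(K◇ h d₁) e p = mcutʳ m d (◇-intro (byK◇ h) d₁) e p
    mcutˡ (suc m) d@(P◇ h d₁) e p = mcutʳ m d (□◇-intro (byP◇ h) d₁) e p
    mcutˡ (suc m) d@(D h d₁) e p = mcutʳ m d (□◇-intro (byD h) d₁) e p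
    mcutˡ (suc m) d@(CD h d₁) e p = mcutʳ m d (□◇-intro (byCD h) d₁) e p
    mcutˡ (suc m) d@(T◇ h d₁) e p = mcutʳ m d (T◇-intro h d₁) e p

    mcutʳ m d ri (perm q e) p = mcutˡ (suc m) d e (trans q p)
    mcutʳ m {Γ} d ri ax p with singleton↭replicate-inv m p
    ... | refl , refl , refl = perm (↭-sym (++-identityʳ Γ)) d
    mcutʳ m d ri (R∧ e₁ e₂) p = R∧ (mcutˡ (suc m) d e₁ p) (mcutˡ (suc m) d e₂ p)
    mcutʳ m d ri (R∨₁ e) p = R∨₁ (mcutˡ (suc m) d e p)
    mcutʳ m d ri (R∨₂ e) p = R∨₂ (mcutˡ (suc m) d e p)
    mcutʳ m {Γ} d ri (R⇒ e) p = R⇒ (moveFront Γ (mcutˡ (suc m) d e (↭-prep-replicate (suc m) p)))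
    mcutʳ m d ri (T◇ h e) p = T◇ h (mcutˡ (suc m) d e p)
    mcutʳ m d ri (N□ _ _) p = ⊥-elim (¬[]↭∷ p)
    mcutʳ m d ri (P◇ _ _) p = ⊥-elim (¬[]↭∷ p)
    mcutʳ m d ri (M□ h e) p = cut-□rule m mc ri (byM□ h) e p
    mcutʳ m d ri (C□ h e) p = cut-□rule m mc ri (byC□ h) e p
    mcutʳ m d ri (K□ h e) p = cut-□rule m mc ri (byK□ h) e p
    mcutʳ m d ri (M◇ h e) p = cut-◇rule m mc ri (byM◇ h) e p
    mcutʳ m d ri (K◇ h e) p = cut-◇rule m mc ri (byK◇ h) e p
    mcutʳ m d ri (D h e) p = cut-□◇rule m mc ri (byD h) e p
    mcutʳ m d ri (CD h e) p = cut-□◇rule m mc ri (byCD h) e p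
    mcutʳ m {Γ} d ri (L∧₁ e) p with occurrence m p
    ... | cut-formula q = principal-∧₁ mc ri (mcutˡ m d e (↭-prep-replicate m q))
    ... | side-formula q q′ = leftRule-middle Γ L∧₁ q (mcutˡ (suc m) d e (↭-prep-replicate (suc m) q′))
    mcutʳ m {Γ} d ri (L∧₂ e) p with occurrence m p
    ... | cut-formula q = principal-∧₂ mc ri (mcutˡ m d e (↭-prep-replicate m q))
    ... | side-formula q q′ = leftRule-middle Γ L∧₂ q (mcutˡ (suc m) d e (↭-prep-replicate (suc m) q′))
    mcutʳ m {Γ} d ri (L∨ e₁ e₂) p with occurrence m p
    ... | cut-formula q =
          principal-∨ mc ri (mcutˡ m d e₁ (↭-prep-replicate m q)) (mcutˡ m d e₂ (↭-prep-replicate m q))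
    ... | side-formula q q′ =
          moveBack Γ q (L∨ (moveFront Γ (mcutˡ (suc m) d e₁ (↭-prep-replicate (suc m) q′)))
                           (moveFront Γ (mcutˡ (suc m) d e₂ (↭-prep-replicate (suc m) q′))))
    mcutʳ m {Γ} d ri (L⇒ e₁ e₂) p with occurrence m p
    ... | cut-formula q = principal-⇒ mc ri (mcutˡ m d e₁ q) (mcutˡ m d e₂ (↭-prep-replicate m q))
    ... | side-formula q q′ =
          moveBack Γ q (L⇒ (mcutˡ (suc m) d e₁ q′) (moveFront Γ (mcutˡ (suc m) d e₂ (↭-prep-replicate (suc m) q′))))
    mcutʳ m {Γ} d ri (T□ h e) p with occurrence m p
    ... | cut-formula q = principal-T□ h mc ri (mcutˡ m d e (↭-prep-replicate m q))
    ... | side-formula q q′ = leftRule-middle Γ (T□ h) q (mcutˡ (suc m) d e (↭-prep-replicate (suc m) q′))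
    mcutʳ m {Γ} d ri (LW e) p with occurrence m p
    ... | cut-formula q = mcutˡ m d e q
    ... | side-formula q q′ = moveBack Γ q (LW (mcutˡ (suc m) d e q′))
    mcutʳ m {Γ} d ri (LC {A = B} e) p with occurrence m p
    ... | cut-formula q = mcutˡ (suc (suc m)) d e (prep B (prep B q))
    ... | side-formula {zs′ = Σ′} q q′ =
          moveBack Γ q (LC (perm (prep B (shift B Γ Σ′))
            (moveFront Γ (mcutˡ (suc m) d e (↭-prep-replicate (suc m) (↭-prep-replicate (suc m) q′))))))

  multicut : ∀ A → MultiCut A
  multicutSub : ∀ A → MultiCutSub A
  multicut A = mcutˡ (multicutSub A)
  multicutSub (var _)  = _
  multicutSub ⊥'       = _
  multicutSub (A ∧' B) = multicut A , multicut B
  multicutSub (A ∨' B) = multicut A , multicut B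
  multicutSub (A ⇒' B) = multicut A , multicut B
  multicutSub (□ A)    = multicut A
  multicutSub (◇ A)    = multicut A

mainTheorem16 : (L : Calc) → ∀ {Γ Σ A C} →
    L ⊢ Γ ⇒ A → L ⊢ A ∷ Σ ⇒ C → L ⊢ Γ ++ Σ ⇒ C
mainTheorem16 L {A = A} d e = multicut L A 1 d e ↭-refl
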